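{- Fix $N\ge 1$ and let $A$ be any set of eligible prefixes for $\mathrm{Av}_N(231)$ such that no element of $A$ is a prefix flattening of another element of $A$. Then the strike strategy with strike set $A$ — accept the candidate at the first position $i$ with $\pi|_{[i]}\in A$, and accept the last candidate if there is no such $i$ — is optimal for the restricted game of best choice on $\mathrm{Av}_N(231)$.
   Context: $\mathrm{Av}_N(231)$ is the set of permutations $\pi=\pi_1\cdots\pi_N$ of $[N]$ with no indices $a<b<c$ such that $\pi_c<\pi_a<\pi_b$. The $i$th prefix flattening $\pi|_{[i]}$ is the permutation of $[i]$ in the same relative order as $\pi_1,\dots,\pi_i$. A prefix is a permutation $p$ of $[k]$, $1\le k\le N$, with $p=\pi|_{[k]}$ for some $\pi\in\mathrm{Av}_N(231)$; a prefix $q$ of size $k$ has $p$ as a prefix flattening if $q|_{[j]}=p$ where $j$ is the size of $p$. A prefix $p=p_1\cdots p_k$ is eligible if $p_k=k$. The restricted game of best choice on a set $I_N$: $\pi$ is chosen uniformly at random from $I_N$; for $i=1,2,\dots$ the player is shown $\pi|_{[i]}$ and, using only $\pi|_{[1]},\dots,\pi|_{[i]}$, accepts candidate $i$ (ending the game) or rejects it forever; if all earlier candidates are rejected candidate $N$ is accepted; the player wins iff the accepted candidate $i$ has $\pi_i=N$. A strategy is optimal if it maximizes the winning probability. -}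

module Defs where

open import Data.Nat using (ℕ; zero; suc; _≤_; _<ᵇ_; _≡ᵇ_; _∸_)
open import Data.Bool using (Bool; true; false; _∧_; _∨_; not; if_then_else_)
open import Data.List using (List; []; _∷_; [_]; map; concatMap; length; take; applyUpTo; last)
open import Data.List.Membership.Propositional using (_∈_)
open import Data.Maybe using (Maybe; just; nothing)
open import Data.Product using (Σ; _×_; ∃)
open import Relation.Binary.PropositionalEquality using (_≡_)
open import Function using (_∘_)

anyᵇ : {A : Set} → (A → Bool) → List A → Bool
anyᵇ p []       = false
anyᵇ p (x ∷ xs) = p x ∨ anyᵇ p xs

filterᵇ : {A : Set} → (A → Bool) → List A → List A
filterᵇ p []       = []
filterᵇ p (x ∷ xs) = if p x then x ∷ filterᵇ p xs else filterᵇ p xs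

countᵇ : {A : Set} → (A → Bool) → List A → ℕ
countᵇ p xs = length (filterᵇ p xs)

-- Permutations of [N] are lists π₁ ⋯ π_N of the values 1..N (1-indexed positions).

insertAll : ℕ → List ℕ → List (List ℕ)
insertAll x []       = [ x ∷ [] ]
insertAll x (y ∷ ys) = (x ∷ y ∷ ys) ∷ map (y ∷_) (insertAll x ys)

perms : ℕ → List (List ℕ)
perms zero    = [ [] ]
perms (suc n) = concatMap (insertAll (suc n)) (perms n)

startsAt : ℕ → List ℕ → Bool
startsAt x []       = false
startsAt x (y ∷ ys) = ((x <ᵇ y) ∧ anyᵇ (λ z → z <ᵇ x) ys) ∨ startsAt x ys

has231 : List ℕ → Bool
has231 []       = false
has231 (x ∷ xs) = startsAt x xs ∨ has231 xs

Av231 : ℕ → List (List ℕ)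
Av231 N = filterᵇ (λ π → not (has231 π)) (perms N)

flatten : List ℕ → List ℕ
flatten xs = map (λ x → suc (countᵇ (λ z → z <ᵇ x) xs)) xs

prefixFlat : ℕ → List ℕ → List ℕ
prefixFlat i π = flatten (take i π)

IsPrefix : ℕ → List ℕ → Set
IsPrefix N p = Σ ℕ λ k → (1 ≤ k) × (k ≤ N) × ∃ λ π → (π ∈ Av231 N) × (p ≡ prefixFlat k π)

Eligible : List ℕ → Set
Eligible p = last p ≡ just (length p)

-- A (deterministic) strategy: decides, from the current prefix flattening π|_[i]
-- (which determines π|_[1],…,π|_[i] and i), whether to accept candidate i.
Strategy : Set
Strategy = List ℕ → Bool

-- 1-indexed lookup with default 0
at : List ℕ → ℕ → ℕ
at []       _             = 0
at (x ∷ xs) zero          = 0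
at (x ∷ xs) (suc zero)    = x
at (x ∷ xs) (suc (suc i)) = at xs (suc i)

pick : Strategy → List ℕ → List ℕ → ℕ
pick s π []       = length π
pick s π (i ∷ is) = if s (prefixFlat i π) then i else pick s π is

-- accepted index: the first i ∈ {1,…,N-1} with s(π|_[i]) = true, otherwise N
acceptIndex : Strategy → List ℕ → ℕ
acceptIndex s π = pick s π (applyUpTo suc (length π ∸ 1))

wins : ℕ → Strategy → List ℕ → Bool
wins N s π = at π (acceptIndex s π) ≡ᵇ N

-- number of π ∈ Av_N(231) on which s wins (win probability × |Av_N(231)|)
winCount : ℕ → Strategy → ℕ
winCount N s = countᵇ (wins N s) (Av231 N)

strike : (List ℕ → Bool) → Strategy
strike A = A

-- Deleting the maximum N from π ∈ Av_N(231) leaves σ ∈ Av_{N-1}(231); group the permutations by σ, i.e. look at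
-- the insertions of N into a fixed σ. Until N appears the player sees the prefixes of σ. If N is inserted
-- right before σ_i and the result avoids 231, then σ_1, …, σ_{i-1} < σ_i, so N looks exactly like σ_i would.
-- Hence a strategy can only win on the insertion before the first σ_i it accepts (or at the end): at most once
-- per σ. If a strike set of eligible prefixes first accepts σ_i, then σ_i exceeds everything before it, and
-- inserting N just before σ_i avoids 231 and is accepted; if it accepts nothing, N inserted last wins. So the
-- strike strategy wins exactly once per σ ∈ Av_{N-1}(231), which is optimal.

module Submission where

open import Defs
open import Data.Bool using (Bool; true; false; T; _∧_; _∨_; not; if_then_else_)
open import Data.Bool.Properties using (∨-conicalˡ; ∨-conicalʳ; ∨-zeroʳ; ∧-zeroʳ)
open import Data.Empty using (⊥-elim)
open import Data.List using (List; []; _∷_; [_]; _++_; length; map; take; concatMap; applyUpTo; last)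
open import Data.List.Properties using (++-assoc; map-++; length-map; map-cong-local)
open import Data.List.Relation.Binary.Sublist.Propositional using (_⊆_; []; _∷_; _∷ʳ_; ⊆-refl)
open import Data.List.Relation.Unary.All using (All; []; _∷_)
import Data.List.Relation.Unary.All as All
import Data.List.Relation.Unary.All.Properties as All
open import Data.List.Relation.Unary.AllPairs using ([]; _∷_)
open import Data.List.Relation.Unary.Unique.Propositional using (Unique)
open import Data.Maybe using (just)
open import Data.Maybe.Properties using (just-injective)
open import Data.Nat using (ℕ; zero; suc; _+_; _≤_; _<_; _<ᵇ_; _≡ᵇ_; z≤n; s≤s)
open import Data.Nat.ListAction using (sum)
open import Data.Nat.Properties
  using ( <ᵇ⇒<; ≤-refl; ≤-reflexive; ≤-trans; <⇒≤; <-trans; ≤∧≢⇒<; <-irrefl; m≤n⇒m≤1+n; m≤n+m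
        ; +-mono-≤; +-suc; +-identityʳ; +-assoc; suc-injective; module ≤-Reasoning)
open import Data.Product using (_×_; _,_; proj₂)
open import Function using (_∘_; id)
open import Relation.Binary.PropositionalEquality hiding ([_])

private
  variable
    A B : Set

<⇒<ᵇ≡true : ∀ {m n} → m < n → (m <ᵇ n) ≡ true
<⇒<ᵇ≡true {zero}  {suc n} _         = refl
<⇒<ᵇ≡true {suc m} {suc n} (s≤s m<n) = <⇒<ᵇ≡true m<n

<ᵇ≡true⇒< : ∀ m n → (m <ᵇ n) ≡ true → m < n
<ᵇ≡true⇒< m n e = <ᵇ⇒< m n (subst T (sym e) _)

≤⇒<ᵇ≡false : ∀ {m n} → n ≤ m → (m <ᵇ n) ≡ false
≤⇒<ᵇ≡false {m}     {zero}  _         = refl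
≤⇒<ᵇ≡false {suc m} {suc n} (s≤s n≤m) = ≤⇒<ᵇ≡false n≤m

<ᵇ≡false⇒≤ : ∀ m n → (m <ᵇ n) ≡ false → n ≤ m
<ᵇ≡false⇒≤ m       zero    _ = z≤n
<ᵇ≡false⇒≤ (suc m) (suc n) e = s≤s (<ᵇ≡false⇒≤ m n e)

≡ᵇ-refl : ∀ m → (m ≡ᵇ m) ≡ true
≡ᵇ-refl zero    = refl
≡ᵇ-refl (suc m) = ≡ᵇ-refl m

<⇒≡ᵇ≡false : ∀ {m n} → m < n → (m ≡ᵇ n) ≡ false
<⇒≡ᵇ≡false {zero}  {suc n} _         = refl
<⇒≡ᵇ≡false {suc m} {suc n} (s≤s m<n) = <⇒≡ᵇ≡false m<n

∨-mono : ∀ {a b c d} → (a ≡ true → c ≡ true) → (b ≡ true → d ≡ true) → a ∨ b ≡ true → c ∨ d ≡ true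
∨-mono {true}          f g _ rewrite f refl = refl
∨-mono {false} {true}  f g _ rewrite g refl = ∨-zeroʳ _

∧-mono : ∀ {a b c d} → (a ≡ true → c ≡ true) → (b ≡ true → d ≡ true) → a ∧ b ≡ true → c ∧ d ≡ true
∧-mono {true} {true} f g _ rewrite f refl | g refl = refl

∨-introʳ : ∀ a {b} → b ≡ true → a ∨ b ≡ true
∨-introʳ a refl = ∨-zeroʳ a

indicator : Bool → ℕ
indicator true  = 1
indicator false = 0

indicator≤1 : ∀ b → indicator b ≤ 1
indicator≤1 true  = ≤-refl
indicator≤1 false = z≤n

count : (A → Bool) → List A → ℕ
count p []       = 0
count p (a ∷ as) = indicator (p a) + count p as

countᵇ≡count : (p : A → Bool) (as : List A) → countᵇ p as ≡ count p as
countᵇ≡count p []       = refl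
countᵇ≡count p (a ∷ as) with p a
... | true  = cong suc (countᵇ≡count p as)
... | false = countᵇ≡count p as

count-filterᵇ : (p q : A → Bool) (as : List A) → count p (filterᵇ q as) ≡ count (λ a → q a ∧ p a) as
count-filterᵇ p q []       = refl
count-filterᵇ p q (a ∷ as) with q a
... | true  = cong (indicator (p a) +_) (count-filterᵇ p q as)
... | false = count-filterᵇ p q as

count-++ : (p : A → Bool) (as bs : List A) → count p (as ++ bs) ≡ count p as + count p bs
count-++ p []       bs = refl
count-++ p (a ∷ as) bs = trans (cong (indicator (p a) +_) (count-++ p as bs)) (sym (+-assoc (indicator (p a)) _ _))

count-map : (p : B → Bool) (f : A → B) (as : List A) → count p (map f as) ≡ count (λ a → p (f a)) as
count-map p f []       = refl
count-map p f (a ∷ as) = cong (indicator (p (f a)) +_) (count-map p f as)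

count-cong : {p q : A → Bool} {as : List A} → All (λ a → p a ≡ q a) as → count p as ≡ count q as
count-cong []       = refl
count-cong (e ∷ es) = cong₂ _+_ (cong indicator e) (count-cong es)

count-none : {p : A → Bool} {as : List A} → All (λ a → p a ≡ false) as → count p as ≡ 0
count-none []       = refl
count-none (e ∷ es) rewrite e = count-none es

count≤length : (p : A → Bool) (as : List A) → count p as ≤ length as
count≤length p []       = z≤n
count≤length p (a ∷ as) with p a
... | true  = s≤s (count≤length p as)
... | false = m≤n⇒m≤1+n (count≤length p as)

count≡length⇒all : (p : A → Bool) (as : List A) → count p as ≡ length as → All (λ a → p a ≡ true) as
count≡length⇒all p []       _ = []
count≡length⇒all p (a ∷ as) e with p a in pa
... | true  = pa ∷ count≡length⇒all p as (suc-injective e)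
... | false = ⊥-elim (<-irrefl e (s≤s (count≤length p as)))

count-concatMap : (p : B → Bool) (f : A → List B) (as : List A)
                → count p (concatMap f as) ≡ sum (map (λ a → count p (f a)) as)
count-concatMap p f []       = refl
count-concatMap p f (a ∷ as) =
  trans (count-++ p (f a) (concatMap f as)) (cong (count p (f a) +_) (count-concatMap p f as))

sum-map-mono : {f g : A → ℕ} {as : List A} → All (λ a → f a ≤ g a) as → sum (map f as) ≤ sum (map g as)
sum-map-mono []       = z≤n
sum-map-mono (h ∷ hs) = +-mono-≤ h (sum-map-mono hs)

insertAll-all : {P : ℕ → Set} {x : ℕ} (σ : List ℕ) → P x → All P σ → All (All P) (insertAll x σ)
insertAll-all []       px []         = (px ∷ []) ∷ []
insertAll-all (y ∷ ys) px (py ∷ pys) = (px ∷ py ∷ pys) ∷ All.map⁺ (All.map (py ∷_) (insertAll-all ys px pys))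

insertAll-unique : ∀ x σ → All (x ≢_) σ → Unique σ → All Unique (insertAll x σ)
insertAll-unique x []       []           []          = ([] ∷ []) ∷ []
insertAll-unique x (y ∷ ys) (x≢y ∷ x∉ys) (y∉ys ∷ u) =
  ((x≢y ∷ x∉ys) ∷ y∉ys ∷ u) ∷
  All.map⁺ (All.zipWith (λ (y∉τ , uτ) → y∉τ ∷ uτ)
                        (insertAll-all ys (x≢y ∘ sym) y∉ys , insertAll-unique x ys x∉ys u))

insertAll-⊇ : ∀ x σ → All (σ ⊆_) (insertAll x σ)
insertAll-⊇ x []       = (x ∷ʳ []) ∷ []
insertAll-⊇ x (y ∷ ys) = (x ∷ʳ ⊆-refl) ∷ All.map⁺ (All.map (refl ∷_) (insertAll-⊇ x ys))

insertAll-nonempty : {P : List ℕ → Set} → ∀ x σ → (∀ t ts → P (t ∷ ts)) → All P (insertAll x σ)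
insertAll-nonempty x []       f = f x [] ∷ []
insertAll-nonempty x (y ∷ ys) f = f x (y ∷ ys) ∷ All.map⁺ (insertAll-nonempty x ys (λ t ts → f y (t ∷ ts)))

count-insertAll-∷ : (p : List ℕ → Bool) → ∀ x y ys
                  → count p (insertAll x (y ∷ ys)) ≡ indicator (p (x ∷ y ∷ ys)) + count (λ τ → p (y ∷ τ)) (insertAll x ys)
count-insertAll-∷ p x y ys = cong (indicator (p (x ∷ y ∷ ys)) +_) (count-map p (y ∷_) (insertAll x ys))

perms-bounded-unique : ∀ n → All (λ σ → All (_< suc n) σ × Unique σ) (perms n)
perms-bounded-unique zero    = ([] , []) ∷ []
perms-bounded-unique (suc n) =
  All.concat⁺ (All.map⁺ (All.map insert-max (perms-bounded-unique n)))
  where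
  insert-max : ∀ {σ} → All (_< suc n) σ × Unique σ
             → All (λ τ → All (_< suc (suc n)) τ × Unique τ) (insertAll (suc n) σ)
  insert-max {σ} (σ<n , u) = All.zipWith id
    ( insertAll-all σ ≤-refl (All.map m≤n⇒m≤1+n σ<n)
    , insertAll-unique (suc n) σ (All.map (λ r<n n≡r → <-irrefl (sym n≡r) r<n) σ<n) u)

anyᵇ-mono : (p : ℕ → Bool) → ∀ {u v} → u ⊆ v → anyᵇ p u ≡ true → anyᵇ p v ≡ true
anyᵇ-mono p []           h = h
anyᵇ-mono p (y ∷ʳ u⊆v)   h = ∨-introʳ (p y) (anyᵇ-mono p u⊆v h)
anyᵇ-mono p (refl ∷ u⊆v) h = ∨-mono id (anyᵇ-mono p u⊆v) h

startsAt-mono : ∀ r {u v} → u ⊆ v → startsAt r u ≡ true → startsAt r v ≡ true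
startsAt-mono r []           h = h
startsAt-mono r (y ∷ʳ u⊆v)   h = ∨-introʳ _ (startsAt-mono r u⊆v h)
startsAt-mono r (refl ∷ u⊆v) h = ∨-mono (∧-mono id (anyᵇ-mono _ u⊆v)) (startsAt-mono r u⊆v) h

has231-mono : ∀ {u v} → u ⊆ v → has231 u ≡ true → has231 v ≡ true
has231-mono []           h = h
has231-mono (y ∷ʳ u⊆v)   h = ∨-introʳ _ (has231-mono u⊆v h)
has231-mono (refl ∷ u⊆v) h = ∨-mono (startsAt-mono _ u⊆v) (has231-mono u⊆v) h

anyᵇ-++-none : (p : ℕ → Bool) (u : List ℕ) {v : List ℕ} → anyᵇ p v ≡ false → anyᵇ p (u ++ v) ≡ anyᵇ p u
anyᵇ-++-none p []      h = h
anyᵇ-++-none p (a ∷ u) h = cong (p a ∨_) (anyᵇ-++-none p u h)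

startsAt-no-smaller : ∀ r v → anyᵇ (λ z → z <ᵇ r) v ≡ false → startsAt r v ≡ false
startsAt-no-smaller r []      _ = refl
startsAt-no-smaller r (a ∷ v) h
  rewrite ∨-conicalʳ (a <ᵇ r) _ h | ∧-zeroʳ (r <ᵇ a) = startsAt-no-smaller r v (∨-conicalʳ _ _ h)

startsAt-++-no-smaller : ∀ r u v → anyᵇ (λ z → z <ᵇ r) v ≡ false → startsAt r (u ++ v) ≡ startsAt r u
startsAt-++-no-smaller r []      v h = startsAt-no-smaller r v h
startsAt-++-no-smaller r (a ∷ u) v h =
  cong₂ (λ c d → (r <ᵇ a) ∧ c ∨ d) (anyᵇ-++-none _ u h) (startsAt-++-no-smaller r u v h)

startsAt-maximum : ∀ x τ → All (_≤ x) τ → startsAt x τ ≡ false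
startsAt-maximum x []      []           = refl
startsAt-maximum x (a ∷ τ) (a≤x ∷ τ≤x) rewrite ≤⇒<ᵇ≡false a≤x = startsAt-maximum x τ τ≤x

startsAt≡false⇒no-smaller-after : ∀ r u b w → r < b → startsAt r (u ++ b ∷ w) ≡ false
                                → anyᵇ (λ z → z <ᵇ r) w ≡ false
startsAt≡false⇒no-smaller-after r []      b w r<b h =
  subst (λ c → c ∧ anyᵇ (λ z → z <ᵇ r) w ≡ false) (<⇒<ᵇ≡true r<b) (∨-conicalˡ _ _ h)
startsAt≡false⇒no-smaller-after r (a ∷ u) b w r<b h =
  startsAt≡false⇒no-smaller-after r u b w r<b (∨-conicalʳ _ _ h)

avoids231⇒no-smaller-after : ∀ ρ b w → All (_< b) ρ → has231 (ρ ++ b ∷ w) ≡ false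
                           → All (λ r → anyᵇ (λ z → z <ᵇ r) w ≡ false) ρ
avoids231⇒no-smaller-after []      b w []          _ = []
avoids231⇒no-smaller-after (r ∷ ρ) b w (r<b ∷ ρ<b) h =
  startsAt≡false⇒no-smaller-after r ρ b w r<b (∨-conicalˡ _ _ h) ∷
  avoids231⇒no-smaller-after ρ b w ρ<b (∨-conicalʳ _ _ h)

no-smaller-∷ : ∀ {r x} τ → r ≤ x → anyᵇ (λ z → z <ᵇ r) τ ≡ false → anyᵇ (λ z → z <ᵇ r) (x ∷ τ) ≡ false
no-smaller-∷ τ r≤x none rewrite ≤⇒<ᵇ≡false r≤x = none

avoids231-insert : ∀ x ρ τ → All (_≤ x) τ → All (λ r → anyᵇ (λ z → z <ᵇ r) (x ∷ τ) ≡ false) ρ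
                 → has231 (ρ ++ τ) ≡ false → has231 (ρ ++ x ∷ τ) ≡ false
avoids231-insert x []      τ τ≤x []          h = cong₂ _∨_ (startsAt-maximum x τ τ≤x) h
avoids231-insert x (r ∷ ρ) τ τ≤x (none ∷ hρ) h =
  cong₂ _∨_ starts-r (avoids231-insert x ρ τ τ≤x hρ (∨-conicalʳ _ _ h))
  where
  open ≡-Reasoning
  starts-r : startsAt r (ρ ++ x ∷ τ) ≡ false
  starts-r = begin
    startsAt r (ρ ++ x ∷ τ) ≡⟨ startsAt-++-no-smaller r ρ (x ∷ τ) none ⟩
    startsAt r ρ            ≡⟨ startsAt-++-no-smaller r ρ τ (∨-conicalʳ _ _ none) ⟨
    startsAt r (ρ ++ τ)     ≡⟨ ∨-conicalˡ _ _ h ⟩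
    false                   ∎

unique-before : (ρ : List ℕ) (y : ℕ) (ys : List ℕ) → Unique (ρ ++ y ∷ ys) → All (_≢ y) ρ
unique-before []      y ys _        = []
unique-before (r ∷ ρ) y ys (r∉ ∷ u) = All.head (All.++⁻ʳ ρ r∉) ∷ unique-before ρ y ys u

length-snoc : (ρ : List A) (x : A) → length (ρ ++ [ x ]) ≡ suc (length ρ)
length-snoc []      x = refl
length-snoc (a ∷ ρ) x = cong suc (length-snoc ρ x)

last-snoc : (ρ : List A) (x : A) → last (ρ ++ [ x ]) ≡ just x
last-snoc []          x = refl
last-snoc (a ∷ [])    x = refl
last-snoc (a ∷ b ∷ ρ) x = last-snoc (b ∷ ρ) x

count-all : {p : A → Bool} {as : List A} → All (λ a → p a ≡ true) as → count p as ≡ length as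
count-all []       = refl
count-all (e ∷ es) rewrite e = cong suc (count-all es)

countᵇ-snoc-false : (p : A → Bool) (ρ : List A) (x : A) → p x ≡ false → countᵇ p (ρ ++ [ x ]) ≡ count p ρ
countᵇ-snoc-false p ρ x px = begin
  countᵇ p (ρ ++ [ x ])             ≡⟨ countᵇ≡count p (ρ ++ [ x ]) ⟩
  count p (ρ ++ [ x ])              ≡⟨ count-++ p ρ [ x ] ⟩
  count p ρ + (indicator (p x) + 0) ≡⟨ cong (λ b → count p ρ + (indicator b + 0)) px ⟩
  count p ρ + 0                     ≡⟨ +-identityʳ _ ⟩
  count p ρ                         ∎
  where open ≡-Reasoning

flatten-snoc-max : ∀ ρ x → All (_< x) ρ → flatten (ρ ++ [ x ]) ≡ flatten ρ ++ [ suc (length ρ) ]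
flatten-snoc-max ρ x ρ<x = begin
  map rank (ρ ++ [ x ])            ≡⟨ map-++ rank ρ [ x ] ⟩
  map rank ρ ++ [ rank x ]         ≡⟨ cong₂ (λ f r → f ++ [ r ]) (map-cong-local (All.map rank-below ρ<x)) rank-x ⟩
  flatten ρ ++ [ suc (length ρ) ] ∎
  where
  open ≡-Reasoning
  rank : ℕ → ℕ
  rank a = suc (countᵇ (λ z → z <ᵇ a) (ρ ++ [ x ]))
  rank-below : ∀ {r} → r < x → rank r ≡ suc (countᵇ (λ z → z <ᵇ r) ρ)
  rank-below r<x = cong suc (trans (countᵇ-snoc-false _ ρ x (≤⇒<ᵇ≡false (<⇒≤ r<x))) (sym (countᵇ≡count _ ρ)))
  rank-x : rank x ≡ suc (length ρ)
  rank-x = cong suc (trans (countᵇ-snoc-false _ ρ x (≤⇒<ᵇ≡false {x} ≤-refl)) (count-all (All.map <⇒<ᵇ≡true ρ<x)))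

flatten-snoc-cong : ∀ ρ x y → All (_< x) ρ → All (_< y) ρ → flatten (ρ ++ [ x ]) ≡ flatten (ρ ++ [ y ])
flatten-snoc-cong ρ x y ρ<x ρ<y = trans (flatten-snoc-max ρ x ρ<x) (sym (flatten-snoc-max ρ y ρ<y))

eligible-snoc⇒max : ∀ ρ y → Eligible (flatten (ρ ++ [ y ])) → All (_< y) ρ
eligible-snoc⇒max ρ y eligible = All.map (<ᵇ≡true⇒< _ y) (count≡length⇒all _ ρ count-below)
  where
  open ≡-Reasoning
  rank : ℕ → ℕ
  rank a = suc (countᵇ (λ z → z <ᵇ a) (ρ ++ [ y ]))
  count-below : count (λ z → z <ᵇ y) ρ ≡ length ρ
  count-below = suc-injective (just-injective (begin
    just (suc (count (λ z → z <ᵇ y) ρ))  ≡⟨ cong (λ c → just (suc c)) (countᵇ-snoc-false _ ρ y (≤⇒<ᵇ≡false {y} ≤-refl)) ⟨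
    just (rank y)                         ≡⟨ last-snoc (map rank ρ) (rank y) ⟨
    last (map rank ρ ++ [ rank y ])       ≡⟨ cong last (map-++ rank ρ [ y ]) ⟨
    last (flatten (ρ ++ [ y ]))           ≡⟨ eligible ⟩
    just (length (flatten (ρ ++ [ y ])))  ≡⟨ cong just (trans (length-map rank (ρ ++ [ y ])) (length-snoc ρ y)) ⟩
    just (suc (length ρ))                 ∎))

take-middle : (ρ : List ℕ) (t : ℕ) (w : List ℕ) → take (suc (length ρ)) (ρ ++ t ∷ w) ≡ ρ ++ [ t ]
take-middle []      t w = refl
take-middle (a ∷ ρ) t w = cong (a ∷_) (take-middle ρ t w)

at-middle : (ρ : List ℕ) (t : ℕ) (w : List ℕ) → at (ρ ++ t ∷ w) (suc (length ρ)) ≡ t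
at-middle []      t w = refl
at-middle (a ∷ ρ) t w = at-middle ρ t w

-- ρ: the candidates already seen and rejected; τ: those still to come. The empty play yields 0, as at does.
acceptedValue : Strategy → List ℕ → List ℕ → ℕ
acceptedValue s ρ []           = 0
acceptedValue s ρ (y ∷ [])     = y
acceptedValue s ρ (y ∷ z ∷ zs) = if s (flatten (ρ ++ [ y ])) then y else acceptedValue s (ρ ++ [ y ]) (z ∷ zs)

acceptedValue-< : ∀ s ρ x t ts → All (_< x) (t ∷ ts) → acceptedValue s ρ (t ∷ ts) < x
acceptedValue-< s ρ x t []         (t<x ∷ _)    = t<x
acceptedValue-< s ρ x t (t′ ∷ ts) (t<x ∷ ts<x) with s (flatten (ρ ++ [ t ]))
... | true  = t<x
... | false = acceptedValue-< s (ρ ++ [ t ]) x t′ ts ts<x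

pick-acceptedValue : ∀ s ρ t ts (f : ℕ → ℕ) → (∀ i → f i ≡ suc (i + length ρ))
                   → at (ρ ++ t ∷ ts) (pick s (ρ ++ t ∷ ts) (applyUpTo f (length ts))) ≡ acceptedValue s ρ (t ∷ ts)
pick-acceptedValue s ρ t [] f _ rewrite length-snoc ρ t = at-middle ρ t []
pick-acceptedValue s ρ t (t′ ∷ ts) f f≡
  rewrite f≡ 0 | cong flatten (take-middle ρ t (t′ ∷ ts)) with s (flatten (ρ ++ [ t ]))
... | true  = at-middle ρ t (t′ ∷ ts)
... | false = subst (λ π → at π (pick s π (applyUpTo (f ∘ suc) (length ts))) ≡ acceptedValue s (ρ ++ [ t ]) (t′ ∷ ts))
                    (++-assoc ρ [ t ] (t′ ∷ ts))
                    (pick-acceptedValue s (ρ ++ [ t ]) t′ ts (f ∘ suc) f∘suc≡)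
  where
  f∘suc≡ : ∀ i → f (suc i) ≡ suc (i + length (ρ ++ [ t ]))
  f∘suc≡ i = trans (f≡ (suc i)) (cong suc (sym (trans (cong (i +_) (length-snoc ρ t)) (+-suc i (length ρ)))))

at-acceptIndex : ∀ s π → at π (acceptIndex s π) ≡ acceptedValue s [] π
at-acceptIndex s []       = refl
at-acceptIndex s (t ∷ ts) = pick-acceptedValue s [] t ts suc (λ i → cong suc (sym (+-identityʳ i)))

winsAfter : Strategy → ℕ → List ℕ → List ℕ → Bool
winsAfter s x ρ τ = not (has231 (ρ ++ τ)) ∧ (acceptedValue s ρ τ ≡ᵇ x)

winCount-by-insertion : ∀ n s
  → winCount (suc n) s ≡ sum (map (λ σ → count (winsAfter s (suc n) []) (insertAll (suc n) σ)) (perms n))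
winCount-by-insertion n s = begin
  countᵇ (wins N s) (Av231 N)                              ≡⟨ countᵇ≡count (wins N s) (Av231 N) ⟩
  count (wins N s) (Av231 N)                               ≡⟨ count-filterᵇ (wins N s) _ (perms N) ⟩
  count (λ π → not (has231 π) ∧ wins N s π) (perms N)      ≡⟨ count-cong {as = perms N} (All.tabulate λ {π} _ → same-play π) ⟩
  count (winsAfter s N []) (perms N)                       ≡⟨ count-concatMap (winsAfter s N []) (insertAll N) (perms n) ⟩
  sum (map (λ σ → count (winsAfter s N []) (insertAll N σ)) (perms n)) ∎
  where
  open ≡-Reasoning
  N = suc n
  same-play : ∀ π → not (has231 π) ∧ wins N s π ≡ winsAfter s N [] π
  same-play π = cong (λ v → not (has231 π) ∧ (v ≡ᵇ N)) (at-acceptIndex s π)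

winsAfter-accepted : ∀ s x ρ y → y < x → s (flatten (ρ ++ [ y ])) ≡ true
                   → ∀ t ts → winsAfter s x ρ (y ∷ t ∷ ts) ≡ false
winsAfter-accepted s x ρ y y<x accept t ts rewrite accept | <⇒≡ᵇ≡false y<x = ∧-zeroʳ _

winsAfter-rejected : ∀ s x ρ y → s (flatten (ρ ++ [ y ])) ≡ false
                   → ∀ t ts → winsAfter s x ρ (y ∷ t ∷ ts) ≡ winsAfter s x (ρ ++ [ y ]) (t ∷ ts)
winsAfter-rejected s x ρ y reject t ts rewrite reject | ++-assoc ρ [ y ] (t ∷ ts) = refl

avoids231⇒below-after-max : ∀ x ρ y ys → All (_< x) ρ → Unique (ρ ++ y ∷ ys) → has231 (ρ ++ x ∷ y ∷ ys) ≡ false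
                          → All (_< y) ρ
avoids231⇒below-after-max x ρ y ys ρ<x u avoids =
  All.zipWith (λ (none , r≢y) → ≤∧≢⇒< (<ᵇ≡false⇒≤ _ _ (∨-conicalˡ _ _ none)) r≢y)
              (avoids231⇒no-smaller-after ρ x (y ∷ ys) ρ<x avoids , unique-before ρ y ys u)

-- x arrives looking exactly like y, so s rejects it too and goes on to accept a smaller value.
winsAfter-insert-before-rejected : ∀ s x ρ y ys → All (_< x) ρ → All (_< x) (y ∷ ys) → Unique (ρ ++ y ∷ ys)
                                 → s (flatten (ρ ++ [ y ])) ≡ false → winsAfter s x ρ (x ∷ y ∷ ys) ≡ false
winsAfter-insert-before-rejected s x ρ y ys ρ<x y∷ys<x u reject with has231 (ρ ++ x ∷ y ∷ ys) in avoids
... | true  = refl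
... | false
  rewrite flatten-snoc-cong ρ x y ρ<x (avoids231⇒below-after-max x ρ y ys ρ<x u avoids) | reject
  = <⇒≡ᵇ≡false (acceptedValue-< s (ρ ++ [ x ]) x y ys y∷ys<x)

avoids231-insert-before-larger : ∀ x ρ y ys → All (_< y) ρ → All (_< x) (y ∷ ys) → has231 (ρ ++ y ∷ ys) ≡ false
                               → has231 (ρ ++ x ∷ y ∷ ys) ≡ false
avoids231-insert-before-larger x ρ y ys ρ<y y∷ys<x@(y<x ∷ _) avoids =
  avoids231-insert x ρ (y ∷ ys) (All.map <⇒≤ y∷ys<x) no-smaller avoids
  where
  no-smaller : All (λ r → anyᵇ (λ z → z <ᵇ r) (x ∷ y ∷ ys) ≡ false) ρ
  no-smaller = All.zipWith
    (λ (r<y , none) → no-smaller-∷ (y ∷ ys) (<⇒≤ (<-trans r<y y<x)) (no-smaller-∷ ys (<⇒≤ r<y) none))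
    (ρ<y , avoids231⇒no-smaller-after ρ y ys ρ<y avoids)

winsAfter-insert-before-accepted : ∀ s x ρ y ys → All (_< y) ρ → All (_< x) (y ∷ ys) → has231 (ρ ++ y ∷ ys) ≡ false
                                 → s (flatten (ρ ++ [ y ])) ≡ true → winsAfter s x ρ (x ∷ y ∷ ys) ≡ true
winsAfter-insert-before-accepted s x ρ y ys ρ<y y∷ys<x@(y<x ∷ _) avoids accept
  rewrite avoids231-insert-before-larger x ρ y ys ρ<y y∷ys<x avoids
        | flatten-snoc-cong ρ x y (All.map (λ r<y → <-trans r<y y<x) ρ<y) ρ<y | accept
  = ≡ᵇ-refl x

winning-insertions-≤1 : ∀ s x ρ σ → All (_< x) ρ → All (_< x) σ → Unique (ρ ++ σ)
                      → count (winsAfter s x ρ) (insertAll x σ) ≤ 1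
winning-insertions-≤1 s x ρ [] _ _ _ = ≤-trans (≤-reflexive (+-identityʳ _)) (indicator≤1 _)
winning-insertions-≤1 s x ρ (y ∷ ys) ρ<x y∷ys<x@(y<x ∷ ys<x) u with s (flatten (ρ ++ [ y ])) in decision
... | true = begin
  count (winsAfter s x ρ) (insertAll x (y ∷ ys))
    ≡⟨ count-insertAll-∷ (winsAfter s x ρ) x y ys ⟩
  indicator (winsAfter s x ρ (x ∷ y ∷ ys)) + count (λ τ → winsAfter s x ρ (y ∷ τ)) (insertAll x ys)
    ≡⟨ cong (indicator (winsAfter s x ρ (x ∷ y ∷ ys)) +_)
            (count-none (insertAll-nonempty x ys (winsAfter-accepted s x ρ y y<x decision))) ⟩
  indicator (winsAfter s x ρ (x ∷ y ∷ ys)) + 0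
    ≡⟨ +-identityʳ _ ⟩
  indicator (winsAfter s x ρ (x ∷ y ∷ ys))
    ≤⟨ indicator≤1 _ ⟩
  1 ∎
  where open ≤-Reasoning
... | false = begin
  count (winsAfter s x ρ) (insertAll x (y ∷ ys))
    ≡⟨ count-insertAll-∷ (winsAfter s x ρ) x y ys ⟩
  indicator (winsAfter s x ρ (x ∷ y ∷ ys)) + count (λ τ → winsAfter s x ρ (y ∷ τ)) (insertAll x ys)
    ≡⟨ cong₂ _+_ (cong indicator (winsAfter-insert-before-rejected s x ρ y ys ρ<x y∷ys<x u decision))
                 (count-cong (insertAll-nonempty x ys (winsAfter-rejected s x ρ y decision))) ⟩
  count (winsAfter s x (ρ ++ [ y ])) (insertAll x ys)
    ≤⟨ winning-insertions-≤1 s x (ρ ++ [ y ]) ys (All.∷ʳ⁺ ρ<x y<x) ys<x (subst Unique (sym (++-assoc ρ [ y ] ys)) u) ⟩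
  1 ∎
  where open ≤-Reasoning

strike-winning-insertions-≥1 : ∀ A x → (∀ p → A p ≡ true → Eligible p) → ∀ ρ σ → All (_< x) ρ → All (_< x) σ
                             → has231 (ρ ++ σ) ≡ false → 1 ≤ count (winsAfter A x ρ) (insertAll x σ)
strike-winning-insertions-≥1 A x eligible ρ [] ρ<x [] avoids
  rewrite avoids231-insert x ρ [] [] (All.map (λ r<x → no-smaller-∷ [] (<⇒≤ r<x) refl) ρ<x) avoids | ≡ᵇ-refl x
  = ≤-refl
strike-winning-insertions-≥1 A x eligible ρ (y ∷ ys) ρ<x y∷ys<x@(y<x ∷ ys<x) avoids
  with A (flatten (ρ ++ [ y ])) in decision
... | true
  rewrite winsAfter-insert-before-accepted A x ρ y ys (eligible-snoc⇒max ρ y (eligible _ decision)) y∷ys<x avoids decision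
  = s≤s z≤n
... | false = begin
  1
    ≤⟨ strike-winning-insertions-≥1 A x eligible (ρ ++ [ y ]) ys (All.∷ʳ⁺ ρ<x y<x) ys<x
                                    (trans (cong has231 (++-assoc ρ [ y ] ys)) avoids) ⟩
  count (winsAfter A x (ρ ++ [ y ])) (insertAll x ys)
    ≡⟨ count-cong (insertAll-nonempty x ys (winsAfter-rejected A x ρ y decision)) ⟨
  count (λ τ → winsAfter A x ρ (y ∷ τ)) (insertAll x ys)
    ≤⟨ m≤n+m _ (indicator (winsAfter A x ρ (x ∷ y ∷ ys))) ⟩
  indicator (winsAfter A x ρ (x ∷ y ∷ ys)) + count (λ τ → winsAfter A x ρ (y ∷ τ)) (insertAll x ys)
    ≡⟨ count-insertAll-∷ (winsAfter A x ρ) x y ys ⟨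
  count (winsAfter A x ρ) (insertAll x (y ∷ ys)) ∎
  where open ≤-Reasoning

insertions-into-231-lose : ∀ s x σ → has231 σ ≡ true → count (winsAfter s x []) (insertAll x σ) ≡ 0
insertions-into-231-lose s x σ has = count-none (All.map loses (insertAll-⊇ x σ))
  where
  loses : ∀ {τ} → σ ⊆ τ → winsAfter s x [] τ ≡ false
  loses {τ} σ⊆τ = cong (λ b → not b ∧ (acceptedValue s [] τ ≡ᵇ x)) (has231-mono σ⊆τ has)

winning-insertions-≤-strike : ∀ s A x σ → (∀ p → A p ≡ true → Eligible p) → All (_< x) σ → Unique σ
                            → count (winsAfter s x []) (insertAll x σ) ≤ count (winsAfter A x []) (insertAll x σ)
winning-insertions-≤-strike s A x σ eligible σ<x u with has231 σ in has
... | true  = ≤-trans (≤-reflexive (insertions-into-231-lose s x σ has)) z≤n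
... | false = ≤-trans (winning-insertions-≤1 s x [] σ [] σ<x u)
                      (strike-winning-insertions-≥1 A x eligible [] σ [] σ<x has)

corollary3p4 : (N : ℕ) → 1 ≤ N → (A : List ℕ → Bool)
    → (∀ p → A p ≡ true → IsPrefix N p × Eligible p)
    → (∀ p q → A p ≡ true → A q ≡ true → p ≢ q → length p ≤ length q → prefixFlat (length p) q ≢ p)
    → (s : Strategy) → winCount N s ≤ winCount N (strike A)
corollary3p4 zero    ()
corollary3p4 (suc n) _ A prefixes _ s = begin
  winCount (suc n) s
    ≡⟨ winCount-by-insertion n s ⟩
  sum (map (λ σ → count (winsAfter s (suc n) []) (insertAll (suc n) σ)) (perms n))
    ≤⟨ sum-map-mono (All.map (λ (σ<N , u) → winning-insertions-≤-strike s A (suc n) _ eligible σ<N u)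
                             (perms-bounded-unique n)) ⟩
  sum (map (λ σ → count (winsAfter A (suc n) []) (insertAll (suc n) σ)) (perms n))
    ≡⟨ winCount-by-insertion n A ⟨
  winCount (suc n) (strike A) ∎
  where
  open ≤-Reasoning
  eligible : ∀ p → A p ≡ true → Eligible p
  eligible p Ap = proj₂ (prefixes p Ap)
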